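{- Let $L$ be a strong model. For $\alpha<\kappa$ let $L|_\alpha=\{x|_\alpha:x\in L\}$ with the order inherited from $L$, and for $\beta<\alpha<\kappa$ let $h^\alpha_\beta:L|_\alpha\to L|_\beta$, $h^\alpha_\beta(x)=x|_\beta$. Then the maps $h^\alpha_\beta$ are completely additive projections between complete lattices forming an inverse system, and $L$ is isomorphic to the stratified complete lattice determined by the limit of this inverse system.
   Context: Fix a limit ordinal $\kappa$. A stratified complete lattice is $(L,\leq,(\sqsubseteq_\alpha)_{\alpha<\kappa})$ where $(L,\leq)$ is a complete lattice and each $\sqsubseteq_\alpha$ is a preorder on $L$; $x=_\alpha y$ means $x\sqsubseteq_\alpha y$ and $y\sqsubseteq_\alpha x$. Axioms: (A1) for $\alpha<\beta<\kappa$, $x\sqsubseteq_\beta y$ implies $x=_\alpha y$; (A2) if $x=_\alpha y$ for all $\alpha<\kappa$ then $x=y$; (A3) for all $x$ and $\alpha<\kappa$ there is $y$ with $x=_\alpha y$ such that for all $z$, $x\sqsubseteq_\alpha z$ implies $y\leq z$ (this $y$ is unique and denoted $x|_\alpha$); (A4$^*$) for all $\alpha<\kappa$, any index set $I$ and $x_i,y_i$ with $x_i=_\alpha y_i$ ($i\in I$), $\bigvee_{i}x_i=_\alpha\bigvee_i y_i$; (A5) $x\leq y$ implies $x|_\alpha\leq y|_\alpha$; (A6) if $x\leq y$ and $x=_\beta y$ for all $\beta<\alpha$ then $x\sqsubseteq_\alpha y$. A strong model satisfies A1, A2, A3, A4$^*$, A5, A6. An isomorphism of stratified complete lattices is a bijection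 $f$ with $x\leq y\iff f(x)\leq f(y)$ and $x\sqsubseteq_\alpha y\iff f(x)\sqsubseteq_\alpha f(y)$ for all $\alpha$. For complete lattices $L,L'$, a monotone $h:L'\to L$ is a projection if there is a monotone $k:L\to L'$ with $h\circ k=\mathrm{id}_L$ and $k(h(y))\leq y$ for all $y\in L'$; $h$ is completely additive if it preserves all suprema. An inverse system: complete lattices $L_\alpha$ ($\alpha<\kappa$) and projections $h^\alpha_\beta:L_\alpha\to L_\beta$ ($\beta<\alpha<\kappa$) with $h^\beta_\gamma\circ h^\alpha_\beta=h^\alpha_\gamma$. Its limit $L_\infty$ is the set of $(x_\alpha)_{\alpha<\kappa}\in\prod L_\alpha$ with $h^\alpha_\beta(x_\alpha)=x_\beta$ for $\beta<\alpha$, ordered pointwise; the stratified complete lattice determined by the limit has $x\sqsubseteq_\alpha y$ iff $x_\alpha\leq y_\alpha$ and $x_\beta=y_\beta$ for all $\beta<\alpha$. -}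

module Defs where

open import Level using (0ℓ)
open import Data.Product using (Σ; ∃; _×_; _,_; proj₁; proj₂)
open import Relation.Binary.Core using (Rel)
open import Relation.Binary.Bundles using (Poset)
open import Relation.Binary.Structures using (IsStrictTotalOrder; IsPreorder; IsPartialOrder)
open import Induction.WellFounded using (WellFounded)
open import Relation.Binary.PropositionalEquality using (_≡_)
import Relation.Binary.Construct.On as On

-- A limit ordinal κ, represented (up to isomorphism) as a well-ordered
-- type: a strict total order that is well-founded, nonempty, and has
-- no largest element.

record LimitOrdinal : Set₁ where
  field
    K                  : Set
    _<_                : Rel K 0ℓ
    isStrictTotalOrder : IsStrictTotalOrder _≡_ _<_
    wellFounded        : WellFounded _<_
    nonempty           : K
    noMax              : ∀ a → ∃ λ b → a < b

record IsCompleteLattice (P : Poset 0ℓ 0ℓ 0ℓ) : Set₁ where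
  open Poset P
  field
    ⋁       : {I : Set} → (I → Carrier) → Carrier
    ⋁-upper : {I : Set} (f : I → Carrier) (i : I) → f i ≤ ⋁ f
    ⋁-least : {I : Set} (f : I → Carrier) (z : Carrier) →
              (∀ i → f i ≤ z) → ⋁ f ≤ z

record CompleteLattice : Set₁ where
  field
    poset             : Poset 0ℓ 0ℓ 0ℓ
    isCompleteLattice : IsCompleteLattice poset
  open Poset poset public
  open IsCompleteLattice isCompleteLattice public

module _ (L' L : CompleteLattice) where
  private
    module L' = CompleteLattice L'
    module L  = CompleteLattice L

  Monotone : (L'.Carrier → L.Carrier) → Set
  Monotone h = ∀ {x y} → x L'.≤ y → h x L.≤ h y

  IsProjection : (L'.Carrier → L.Carrier) → Set
  IsProjection h = Monotone h × Σ (L.Carrier → L'.Carrier) λ k →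
    ((∀ {x y} → x L.≤ y → k x L'.≤ k y)
     × (∀ x → h (k x) L.≈ x)
     × (∀ y → k (h y) L'.≤ y))

  CompletelyAdditive : (L'.Carrier → L.Carrier) → Set₁
  CompletelyAdditive h = ∀ {I : Set} (f : I → L'.Carrier) →
    h (L'.⋁ f) L.≈ L.⋁ (λ i → h (f i))

module Stratified (κ : LimitOrdinal) where
  open LimitOrdinal κ

  record StratStructure : Set₁ where
    field
      Carrier : Set
      _≈_     : Rel Carrier 0ℓ
      _≤_     : Rel Carrier 0ℓ
      _⊑[_]_  : Carrier → K → Carrier → Set

  record Isomorphism (A B : StratStructure) : Set where
    private
      module A = StratStructure A
      module B = StratStructure B
    field
      f      : A.Carrier → B.Carrier
      f-cong : ∀ {x y} → x A.≈ y → f x B.≈ f y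
      f-inj  : ∀ {x y} → f x B.≈ f y → x A.≈ y
      f-surj : ∀ y → ∃ λ x → f x B.≈ y
      f-≤    : ∀ {x y} → (x A.≤ y → f x B.≤ f y) × (f x B.≤ f y → x A.≤ y)
      f-⊑    : ∀ {x y} α →
               (x A.⊑[ α ] y → f x B.⊑[ α ] f y) × (f x B.⊑[ α ] f y → x A.⊑[ α ] y)

  record StratifiedCL : Set₁ where
    field
      lattice : CompleteLattice
    open CompleteLattice lattice public
    field
      _⊑[_]_     : Carrier → K → Carrier → Set
      ⊑-preorder : ∀ α → IsPreorder _≈_ (λ x y → x ⊑[ α ] y)

    _=[_]_ : Carrier → K → Carrier → Set
    x =[ α ] y = x ⊑[ α ] y × y ⊑[ α ] x

    structure : StratStructure
    structure = record { Carrier = Carrier ; _≈_ = _≈_ ; _≤_ = _≤_ ; _⊑[_]_ = _⊑[_]_ }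

  record StrongModel : Set₁ where
    field
      strat : StratifiedCL
    open StratifiedCL strat public
    field
      A1  : ∀ {α β x y} → α < β → x ⊑[ β ] y → x =[ α ] y
      A2  : ∀ {x y} → (∀ α → x =[ α ] y) → x ≈ y
      A3  : ∀ x α → Σ Carrier λ y → x =[ α ] y × (∀ z → x ⊑[ α ] z → y ≤ z)
      A4* : ∀ α {I : Set} (xs ys : I → Carrier) →
            (∀ i → xs i =[ α ] ys i) → ⋁ xs =[ α ] ⋁ ys
    _∣_ : Carrier → K → Carrier
    x ∣ α = proj₁ (A3 x α)
    field
      A5  : ∀ {x y} α → x ≤ y → (x ∣ α) ≤ (y ∣ α)
      A6  : ∀ {x y α} → x ≤ y → (∀ β → β < α → x =[ β ] y) → x ⊑[ α ] y

    -- L|α = { x|α : x ∈ L } with the inherited equality and order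
    RCarrier : K → Set
    RCarrier α = Σ Carrier λ x → Σ Carrier λ y → x ≈ (y ∣ α)

    RPoset : K → Poset 0ℓ 0ℓ 0ℓ
    RPoset α = On.poset poset (proj₁ {B = λ x → Σ Carrier λ y → x ≈ (y ∣ α)})

    RLattice : (α : K) → IsCompleteLattice (RPoset α) → CompleteLattice
    RLattice α cl = record { poset = RPoset α ; isCompleteLattice = cl }

    hR : ∀ α β → RCarrier α → RCarrier β
    hR α β (x , _) = (x ∣ β) , x , Poset.Eq.refl poset

  record InverseSystem : Set₁ where
    field
      L      : K → CompleteLattice
      h      : ∀ {α β} → β < α → CompleteLattice.Carrier (L α) → CompleteLattice.Carrier (L β)
      h-proj : ∀ {α β} (p : β < α) → IsProjection (L α) (L β) (h p)
      h-comp : ∀ {α β γ} (p : β < α) (q : γ < β) (r : γ < α) x →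
               CompleteLattice._≈_ (L γ) (h q (h p x)) (h r x)

    private
      module Lα α = CompleteLattice (L α)

    LimCarrier : Set
    LimCarrier = Σ ((α : K) → Lα.Carrier α) λ x →
                   ∀ {α β} (p : β < α) → Lα._≈_ β (h p (x α)) (x β)

    limit : StratStructure
    limit = record
      { Carrier = LimCarrier
      ; _≈_ = λ x y → ∀ α → Lα._≈_ α (proj₁ x α) (proj₁ y α)
      ; _≤_ = λ x y → ∀ α → Lα._≤_ α (proj₁ x α) (proj₁ y α)
      ; _⊑[_]_ = λ x α y → Lα._≤_ α (proj₁ x α) (proj₁ y α)
                          × (∀ β → β < α → Lα._≈_ β (proj₁ x β) (proj₁ y β))
      }

  Corollary15Conclusion : StrongModel → Set₁
  Corollary15Conclusion M =
    Σ ((α : K) → IsCompleteLattice (RPoset α)) λ cl →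
    Σ (∀ {α β} (p : β < α) → IsProjection (RLattice α (cl α)) (RLattice β (cl β)) (hR α β)) λ proj →
    (∀ {α β} (p : β < α) → CompletelyAdditive (RLattice α (cl α)) (RLattice β (cl β)) (hR α β)) ×
    Σ (∀ {α β γ} (p : β < α) (q : γ < β) (r : γ < α) x →
         CompleteLattice._≈_ (RLattice γ (cl γ)) (hR β γ (hR α β x)) (hR α γ x)) λ comp →
    Isomorphism structure
      (InverseSystem.limit (record
        { L = λ α → RLattice α (cl α)
        ; h = λ {α} {β} _ → hR α β
        ; h-proj = proj
        ; h-comp = comp }))
    where open StrongModel M

module Submission where

-- Everything is driven by the restriction operator x ↦ x|α of axiom A3.
--
-- With these facts L|α is a complete lattice whose suprema are the
-- restrictions (⋁ xᵢ)|α (by A5); h^α_β = (-)|β is a projection whose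
-- section is the inclusion L|β ⊆ L|α, it is completely additive (by A4*),
-- and the maps compose.  The key reconstruction lemma says that a coherent
-- family (aα ∈ L|α) is recovered from its supremum: (⋁ a)|α ≈ aα.  So the
-- map x ↦ (x|α)α into the limit is onto, and it is injective by A2; it
-- preserves and reflects ≤ because x ≈ ⋁α x|α, and ⊑α by A1 and A6.

open import Data.Product using (Σ; _,_; proj₁; proj₂)
open import Relation.Binary.Structures using (IsStrictTotalOrder; IsPreorder)
open import Relation.Binary.Definitions using (tri<; tri≈; tri>)
open import Relation.Binary.PropositionalEquality using (refl)
import Relation.Binary.Reasoning.PartialOrder as PosetReasoning
open import Defs

module _ (κ : LimitOrdinal) (M : Stratified.StrongModel κ) where
  open LimitOrdinal κ
  open Stratified κ
  open StrongModel M
  open PosetReasoning poset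

  private
    module ⊑ α = IsPreorder (⊑-preorder α)

  ⊑-trans : ∀ {α x y z} → x ⊑[ α ] y → y ⊑[ α ] z → x ⊑[ α ] z
  ⊑-trans {α} = ⊑.trans α

  =-reflexive : ∀ {α x y} → x ≈ y → x =[ α ] y
  =-reflexive {α} e = ⊑.reflexive α e , ⊑.reflexive α (Eq.sym e)

  =-sym : ∀ {α x y} → x =[ α ] y → y =[ α ] x
  =-sym (x⊑y , y⊑x) = y⊑x , x⊑y

  =-trans : ∀ {α x y z} → x =[ α ] y → y =[ α ] z → x =[ α ] z
  =-trans (x⊑y , y⊑x) (y⊑z , z⊑y) = ⊑-trans x⊑y y⊑z , ⊑-trans z⊑y y⊑x

  restrict-=[] : ∀ x α → x =[ α ] (x ∣ α)
  restrict-=[] x α = proj₁ (proj₂ (A3 x α))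

  restrict-least : ∀ x α z → x ⊑[ α ] z → (x ∣ α) ≤ z
  restrict-least x α = proj₂ (proj₂ (A3 x α))

  restrict-≤ : ∀ x α → (x ∣ α) ≤ x
  restrict-≤ x α = restrict-least x α x (⊑.refl α)

  restrict-resp : ∀ {x y α} → x =[ α ] y → (x ∣ α) ≈ (y ∣ α)
  restrict-resp {x} {y} {α} (x⊑y , y⊑x) = antisym
    (restrict-least x α _ (⊑-trans x⊑y (proj₁ (restrict-=[] y α))))
    (restrict-least y α _ (⊑-trans y⊑x (proj₁ (restrict-=[] x α))))

  restrict-reflect : ∀ {x y α} → (x ∣ α) ≈ (y ∣ α) → x =[ α ] y
  restrict-reflect {x} {y} {α} e =
    =-trans (restrict-=[] x α) (=-trans (=-reflexive e) (=-sym (restrict-=[] y α)))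

  restrict-cong : ∀ {x y} α → x ≈ y → (x ∣ α) ≈ (y ∣ α)
  restrict-cong α e = restrict-resp (=-reflexive e)

  restrict-idem : ∀ x α → ((x ∣ α) ∣ α) ≈ (x ∣ α)
  restrict-idem x α = restrict-resp (=-sym (restrict-=[] x α))

  restrict-below : ∀ {α β} → β < α → ∀ x → ((x ∣ α) ∣ β) ≈ (x ∣ β)
  restrict-below β<α x = restrict-resp (A1 β<α (proj₂ (restrict-=[] x _)))

  restrict-above : ∀ {α β} → β < α → ∀ x → ((x ∣ β) ∣ α) ≈ (x ∣ β)
  restrict-above {α} {β} β<α x = antisym (restrict-≤ u α) (begin
    u                ≈⟨ restrict-idem x β ⟨
    u ∣ β            ≈⟨ restrict-resp (A1 β<α (proj₁ (restrict-=[] u α))) ⟩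
    (u ∣ α) ∣ β      ≤⟨ restrict-≤ (u ∣ α) β ⟩
    u ∣ α            ∎)
    where u = x ∣ β

  restricted-fixed : ∀ {u w α} → u ≈ (w ∣ α) → (u ∣ α) ≈ u
  restricted-fixed {u} {w} {α} e =
    Eq.trans (restrict-cong α e) (Eq.trans (restrict-idem w α) (Eq.sym e))

  restricted-fixed-above : ∀ {α β u w} → β < α → u ≈ (w ∣ β) → (u ∣ α) ≈ u
  restricted-fixed-above {α} {u = u} {w} β<α e =
    Eq.trans (restrict-cong α e) (Eq.trans (restrict-above β<α w) (Eq.sym e))

  element-fixed : ∀ {α} (u : RCarrier α) → (proj₁ u ∣ α) ≈ proj₁ u
  element-fixed u = restricted-fixed (proj₂ (proj₂ u))

  restrictedComplete : ∀ α → IsCompleteLattice (RPoset α)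
  restrictedComplete α = record
    { ⋁       = λ f → (⋁ (carriers f) ∣ α) , ⋁ (carriers f) , Eq.refl
    ; ⋁-upper = λ f i → begin
        proj₁ (f i)           ≈⟨ element-fixed (f i) ⟨
        proj₁ (f i) ∣ α       ≤⟨ A5 α (⋁-upper (carriers f) i) ⟩
        ⋁ (carriers f) ∣ α    ∎
    ; ⋁-least = λ f z fᵢ≤z → begin
        ⋁ (carriers f) ∣ α    ≤⟨ A5 α (⋁-least (carriers f) (proj₁ z) fᵢ≤z) ⟩
        proj₁ z ∣ α           ≈⟨ element-fixed z ⟩
        proj₁ z               ∎
    }
    where
    carriers : {I : Set} → (I → RCarrier α) → I → Carrier
    carriers f i = proj₁ (f i)

  Restricted : K → CompleteLattice
  Restricted α = RLattice α (restrictedComplete α)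

  inclusion : ∀ {α β} → β < α → RCarrier β → RCarrier α
  inclusion β<α (u , w , e) = u , u , Eq.sym (restricted-fixed-above β<α e)

  restriction-projection : ∀ {α β} (β<α : β < α) →
    IsProjection (Restricted α) (Restricted β) (hR α β)
  restriction-projection {α} {β} β<α =
      A5 β
    , inclusion β<α
    , (λ u≤v → u≤v)
    , element-fixed
    , (λ u → restrict-≤ (proj₁ u) β)

  -- h^α_β preserves suprema: ((⋁ xᵢ)|α)|β ≈ (⋁ xᵢ)|β ≈ (⋁ (xᵢ|β))|β by A4*.
  restriction-additive : ∀ {α β} (β<α : β < α) →
    CompletelyAdditive (Restricted α) (Restricted β) (hR α β)
  restriction-additive {α} {β} β<α f =
    Eq.trans (restrict-below β<α _)
             (restrict-resp (A4* β _ _ (λ i → restrict-=[] (proj₁ (f i)) β)))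

  restriction-compose : ∀ {α β γ} (β<α : β < α) (γ<β : γ < β) (γ<α : γ < α) x →
    CompleteLattice._≈_ (Restricted γ) (hR β γ (hR α β x)) (hR α γ x)
  restriction-compose _ γ<β _ x = restrict-below γ<β (proj₁ x)

  restrictionSystem : InverseSystem
  restrictionSystem = record
    { L      = Restricted
    ; h      = λ {α} {β} _ → hR α β
    ; h-proj = restriction-projection
    ; h-comp = restriction-compose
    }

  module Reconstruction
    (a   : K → Carrier)
    (rep : ∀ α → Σ Carrier λ w → a α ≈ (w ∣ α))
    (coh : ∀ {α β} → β < α → (a α ∣ β) ≈ a β) where

    restricted-family-bounded : ∀ α γ → (a γ ∣ α) ≤ a α
    restricted-family-bounded α γ
      with IsStrictTotalOrder.compare isStrictTotalOrder γ α
    ... | tri< γ<α _ _ = begin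
      a γ ∣ α    ≈⟨ restricted-fixed-above γ<α (proj₂ (rep γ)) ⟩
      a γ        ≈⟨ coh γ<α ⟨
      a α ∣ γ    ≤⟨ restrict-≤ (a α) γ ⟩
      a α        ∎
    ... | tri≈ _ refl _ = reflexive (restricted-fixed (proj₂ (rep α)))
    ... | tri> _ _ α<γ = reflexive (coh α<γ)

    sup-of-restricted-family : ∀ α → ⋁ (λ γ → a γ ∣ α) ≈ a α
    sup-of-restricted-family α = antisym
      (⋁-least _ (a α) (restricted-family-bounded α))
      (begin
        a α                   ≈⟨ restricted-fixed (proj₂ (rep α)) ⟨
        a α ∣ α               ≤⟨ ⋁-upper (λ γ → a γ ∣ α) α ⟩
        ⋁ (λ γ → a γ ∣ α)     ∎)

    -- By A4*, ⋁ a =α ⋁γ (aγ|α) ≈ aα, whence (⋁ a)|α ≈ aα|α ≈ aα.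
    restrict-sup : ∀ α → (⋁ a ∣ α) ≈ a α
    restrict-sup α = Eq.trans
      (restrict-resp (=-trans (A4* α a (λ γ → a γ ∣ α) (λ γ → restrict-=[] (a γ) α))
                              (=-reflexive (sup-of-restricted-family α))))
      (restricted-fixed (proj₂ (rep α)))

  sup-of-restrictions : ∀ x → ⋁ (λ α → x ∣ α) ≈ x
  sup-of-restrictions x = A2 λ α → restrict-reflect (restrict-sup α)
    where open Reconstruction (λ α → x ∣ α) (λ α → x , Eq.refl) (λ β<α → restrict-below β<α x)

  private
    module Lim = StratStructure (InverseSystem.limit restrictionSystem)

  toLimit : Carrier → Lim.Carrier
  toLimit x = (λ α → (x ∣ α) , x , Eq.refl) , (λ β<α → restrict-below β<α x)

  toLimit-injective : ∀ {x y} → toLimit x Lim.≈ toLimit y → x ≈ y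
  toLimit-injective e = A2 λ α → restrict-reflect (e α)

  toLimit-surjective : ∀ y → Σ Carrier λ x → toLimit x Lim.≈ y
  toLimit-surjective (y , coherent) =
    ⋁ (λ α → proj₁ (y α)) , restrict-sup
    where open Reconstruction (λ α → proj₁ (y α)) (λ α → proj₂ (y α)) coherent

  toLimit-reflects-≤ : ∀ {x y} → toLimit x Lim.≤ toLimit y → x ≤ y
  toLimit-reflects-≤ {x} {y} xα≤yα = begin
    x                    ≈⟨ sup-of-restrictions x ⟨
    ⋁ (λ α → x ∣ α)      ≤⟨ ⋁-least _ y (λ α → trans (xα≤yα α) (restrict-≤ y α)) ⟩
    y                    ∎

  toLimit-preserves-⊑ : ∀ {x y} α → x ⊑[ α ] y → toLimit x Lim.⊑[ α ] toLimit y
  toLimit-preserves-⊑ {x} {y} α x⊑y =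
      restrict-least x α (y ∣ α) (⊑-trans x⊑y (proj₁ (restrict-=[] y α)))
    , λ β β<α → restrict-resp (A1 β<α x⊑y)

  -- x =α x|α ⊑α y|α =α y, the middle step by A6 since x|α =β y|β for β < α.
  toLimit-reflects-⊑ : ∀ {x y} α → toLimit x Lim.⊑[ α ] toLimit y → x ⊑[ α ] y
  toLimit-reflects-⊑ {x} {y} α (xα≤yα , xβ≈yβ) =
    ⊑-trans (proj₁ (restrict-=[] x α))
      (⊑-trans (A6 xα≤yα restrictions-agree-below) (proj₂ (restrict-=[] y α)))
    where
    restrictions-agree-below : ∀ β → β < α → (x ∣ α) =[ β ] (y ∣ α)
    restrictions-agree-below β β<α =
      =-trans (A1 β<α (proj₂ (restrict-=[] x α)))
        (=-trans (restrict-reflect (xβ≈yβ β β<α)) (A1 β<α (proj₁ (restrict-=[] y α))))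

  toLimit-isomorphism : Isomorphism structure (InverseSystem.limit restrictionSystem)
  toLimit-isomorphism = record
    { f      = toLimit
    ; f-cong = λ x≈y α → restrict-cong α x≈y
    ; f-inj  = toLimit-injective
    ; f-surj = toLimit-surjective
    ; f-≤    = (λ x≤y α → A5 α x≤y) , toLimit-reflects-≤
    ; f-⊑    = λ α → toLimit-preserves-⊑ α , toLimit-reflects-⊑ α
    }

  limit-representation : Corollary15Conclusion M
  limit-representation =
      restrictedComplete
    , restriction-projection
    , restriction-additive
    , restriction-compose
    , toLimit-isomorphism

corollary15 : (κ : LimitOrdinal) (M : Stratified.StrongModel κ) → Stratified.Corollary15Conclusion κ M
corollary15 = limit-representation
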